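{- Let $n\ge 1$. The set of $w\in W_n$ such that the sequence $(w(1),\dots,w(n))$ has an increasing subsequence of length $n-1$ is equal to the set $\mathcal{C}(n)$ of all consecutive cycles in $W_n$. Consequently, for any unital commutative ring $\Bbbk$, both $\{P(w)\mid w\in\mathcal{C}(n)\}$ and $\{P(ww_0)\mid w\in \mathcal{C}(n)\}$ are $\Bbbk$-bases of the $\Bbbk$-linear span of $\{P(w)\mid w\in W_n\}$.
   Context: $W_n$ is the symmetric group on $\{1,\dots,n\}$, and $P(w)=[\delta_{i,w(j)}]$ is the $n\times n$ permutation matrix of $w$ over $\Bbbk$. For $1\le i$ and $k\ge 1$ with $i+k-1\le n$, let $c_{i,k}\in W_n$ be the permutation sending $j\mapsto j+1$ for $i\le j< i+k-1$, sending $i+k-1\mapsto i$, and fixing all other points (so $c_{i,1}$ is the identity). A consecutive cycle is any $c_{i,k}$ or its inverse. $w_0\in W_n$ is the permutation $j\mapsto n+1-j$, so that $(ww_0)(j)=w(n+1-j)$. -}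

module Defs where

open import Level using (Level; _⊔_; Lift)
open import Data.Bool using (Bool; true; false; if_then_else_; _∧_)
open import Data.Nat using (ℕ; zero; suc) renaming (_+_ to _+ℕ_; _≤_ to _≤ℕ_)
open import Data.Nat using ( _∸_; _≤ᵇ_; _<ᵇ_; _≡ᵇ_)
open import Data.Fin using (Fin; toℕ; _<_; _≟_)
open import Data.Fin.Permutation using (Permutation′; _⟨$⟩ʳ_; _⟨$⟩ˡ_; _∘ₚ_; reverse)
open import Data.Product using (Σ; ∃; ∃-syntax; _×_; _,_; proj₁; proj₂)
open import Data.Sum using (_⊎_)
open import Data.List using (List; []; _∷_; foldr)
open import Data.List.Relation.Unary.All using (All)
open import Data.List.Relation.Unary.AllPairs using (AllPairs)
open import Relation.Nullary using (¬_)
open import Relation.Nullary.Decidable using (⌊_⌋)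
open import Relation.Binary.PropositionalEquality using (_≡_)
open import Algebra.Bundles using (CommutativeRing)

-- Permutations.  W_n = Permutation′ n (bijections Fin n ↔ Fin n).
-- Points are 0-based: the paper's point j ∈ {1..n} is  Fin n  element j-1.

-- The paper's consecutive cycle c_{i+1,k} on 0-based points (as a function on ℕ):
--   j ↦ j+1  for i ≤ j < i+k-1,   i+k-1 ↦ i,   all other points fixed.
cycℕ : ℕ → ℕ → ℕ → ℕ
cycℕ i k j =
  if (i ≤ᵇ j) ∧ (suc j <ᵇ i +ℕ k) then suc j
  else (if j ≡ᵇ (i +ℕ k ∸ 1) then i else j)

IsCycle : ∀ {n} → Permutation′ n → ℕ → ℕ → Set
IsCycle w i k = ∀ j → toℕ (w ⟨$⟩ʳ j) ≡ cycℕ i k (toℕ j)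

IsCycleInv : ∀ {n} → Permutation′ n → ℕ → ℕ → Set
IsCycleInv w i k = ∀ j → toℕ (w ⟨$⟩ˡ j) ≡ cycℕ i k (toℕ j)

IsConsecutiveCycle : ∀ {n} → Permutation′ n → Set
IsConsecutiveCycle {n} w =
  ∃[ i ] ∃[ k ] (1 ≤ℕ k × i +ℕ k ≤ℕ n × (IsCycle w i k ⊎ IsCycleInv w i k))

HasIncreasingSubseq : ∀ {n} → Permutation′ n → ℕ → Set
HasIncreasingSubseq {n} w m =
  Σ (Fin m → Fin n) λ f →
    (∀ a b → a < b → f a < f b) × (∀ a b → a < b → (w ⟨$⟩ʳ f a) < (w ⟨$⟩ʳ f b))

w₀ : ∀ {n} → Permutation′ n
w₀ = reverse

-- composition w w₀ (apply w₀ first); note  π₁ ∘ₚ π₂  applies π₁ first.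
_·w₀ : ∀ {n} → Permutation′ n → Permutation′ n
w ·w₀ = w₀ ∘ₚ w

module Lin {c ℓ : Level} (R : CommutativeRing c ℓ) where
  open CommutativeRing R using (Carrier; _≈_; _+_; _*_; 0#; 1#)

  Matrix : ℕ → Set c
  Matrix n = Fin n → Fin n → Carrier

  _≋_ : ∀ {n} → Matrix n → Matrix n → Set ℓ
  A ≋ B = ∀ i j → A i j ≈ B i j

  0M : ∀ {n} → Matrix n
  0M i j = 0#

  _⊕_ : ∀ {n} → Matrix n → Matrix n → Matrix n
  (A ⊕ B) i j = A i j + B i j

  _⊙_ : ∀ {n} → Carrier → Matrix n → Matrix n
  (a ⊙ A) i j = a * A i j

  P : ∀ {n} → Permutation′ n → Matrix n
  P w i j = if ⌊ i ≟ (w ⟨$⟩ʳ j) ⌋ then 1# else 0#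

  MSet : ℕ → Set (Level.suc (c ⊔ ℓ))
  MSet n = Matrix n → Set (c ⊔ ℓ)

  lincomb : ∀ {n} → List (Carrier × Matrix n) → Matrix n
  lincomb = foldr (λ p acc → (proj₁ p ⊙ proj₂ p) ⊕ acc) 0M

  Span : ∀ {n} → MSet n → MSet n
  Span S M = ∃[ xs ] (All (λ p → S (proj₂ p)) xs × (lincomb xs ≋ M))

  LinIndep : ∀ {n} → MSet n → Set (c ⊔ ℓ)
  LinIndep S = ∀ xs → All (λ p → S (proj₂ p)) xs
             → AllPairs (λ p q → ¬ (proj₂ p ≋ proj₂ q)) xs
             → lincomb xs ≋ 0M → All (λ p → proj₁ p ≈ 0#) xs

  IsBasisOf : ∀ {n} → MSet n → MSet n → Set (c ⊔ ℓ)
  IsBasisOf S V = (∀ M → S M → V M) × (∀ M → V M → Span S M) × LinIndep S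

  AllPermMatrices : ∀ {n} → MSet n
  AllPermMatrices M = Lift (c ⊔ ℓ) (∃[ w ] (P w ≋ M))

  CycleMatrices : ∀ {n} → MSet n
  CycleMatrices M = Lift (c ⊔ ℓ) (∃[ w ] (IsConsecutiveCycle w × (P w ≋ M)))

  CycleW₀Matrices : ∀ {n} → MSet n
  CycleW₀Matrices M = Lift (c ⊔ ℓ) (∃[ w ] (IsConsecutiveCycle w × (P (w ·w₀) ≋ M)))

{-# OPTIONS --safe #-}

-- An increasing map Fin n → Fin (suc n) misses exactly one point p and is punchIn p.
-- Hence w ∈ W_{n+1} has an increasing subsequence of length n iff w = move p q: w sends
-- one point p to q and keeps the order of the others, and these maps are exactly the
-- consecutive cycles and their inverses.
--
-- Spanning: transpositions reduce any permutation to the identity, each step changing the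
-- permutation matrix by a rank-one matrix (e_a - e_b)(e_y - e_y')ᵀ. Such matrices are
-- combinations of those with adjacent columns y = c, y' = c + 1, and these in turn of the
-- differences P (move c q) - P (move (c + 1) q), which are of this form.
-- Independence: P (move p q) has a 1 at (q, p), and any other cycle matrix with a 1 there
-- moves its own point farther, so coefficients vanish by downward induction on ∣ p - q ∣.
-- Permuting the columns by w₀ preserves both arguments.
module Submission where

open import Defs
open import Level using (Level; _⊔_; Lift; lift)
open import Data.Bool using (true; false; T; if_then_else_)
open import Data.Bool.Properties using (∧-zeroʳ; T-≡)
open import Data.Unit using (tt)
open import Data.Empty using (⊥-elim)
open import Data.Nat as ℕ using (ℕ; zero; suc; _≤_; _∸_; z≤n; s≤s; ∣_-_∣; _≤ᵇ_; _<ᵇ_; _≡ᵇ_)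
import Data.Nat.Properties as ℕ
open import Data.Fin as Fin using (Fin; toℕ; inject₁; punchIn; punchOut; fromℕ<)
import Data.Fin.Properties as Fin
open import Data.Fin.Induction using (<-weakInduction)
open import Data.Fin.Permutation as Perm
  using (Permutation′; _⟨$⟩ʳ_; _⟨$⟩ˡ_; _∘ₚ_; insert; transpose; flip; inverseˡ; inverseʳ)
  renaming (_≈_ to _≈ₚ_)
open import Data.List using (List; []; _∷_; _++_; map)
open import Data.List.Relation.Unary.All as All using (All; []; _∷_)
import Data.List.Relation.Unary.All.Properties as All
open import Data.List.Relation.Unary.Any using (here; there)
open import Data.List.Relation.Unary.AllPairs using (AllPairs; []; _∷_)
open import Data.List.Membership.Propositional using (_∈_)
open import Data.Product using (∃-syntax; ∃₂; _×_; _,_; proj₁; proj₂; map₂)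
open import Data.Sum using (_⊎_; inj₁; inj₂)
open import Function using (_∘_)
open import Function.Bundles using (_⇔_; mk⇔; Equivalence)
open import Function.Properties.Equivalence using () renaming (trans to ⇔-trans; sym to ⇔-sym)
open import Relation.Nullary using (¬_; Dec; yes; no; contradiction)
open import Relation.Nullary.Decidable using (⌊_⌋; dec-true; dec-false)
open import Relation.Binary.PropositionalEquality
  using (_≡_; _≢_; refl; sym; trans; cong; cong₂; subst; subst₂; module ≡-Reasoning)
open import Algebra.Bundles using (CommutativeRing)
import Algebra.Properties.Ring as RingProperties

private
  variable
    m n : ℕ

punchIn-cases : (i : Fin (suc n)) (a : Fin n) →
  (a Fin.< i × punchIn i a ≡ inject₁ a) ⊎ (i Fin.≤ a × punchIn i a ≡ Fin.suc a)
punchIn-cases Fin.zero    a           = inj₂ (z≤n , refl)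
punchIn-cases (Fin.suc i) Fin.zero    = inj₁ (s≤s z≤n , refl)
punchIn-cases (Fin.suc i) (Fin.suc a) with punchIn-cases i a
... | inj₁ (a<i , e) = inj₁ (s≤s a<i , cong Fin.suc e)
... | inj₂ (i≤a , e) = inj₂ (s≤s i≤a , cong Fin.suc e)

punchIn-inject₁ : (p : Fin n) → punchIn (inject₁ p) p ≡ Fin.suc p
punchIn-inject₁ Fin.zero    = refl
punchIn-inject₁ (Fin.suc p) = cong Fin.suc (punchIn-inject₁ p)

⟨$⟩ʳ-injective : (w : Permutation′ n) → ∀ {x y} → w ⟨$⟩ʳ x ≡ w ⟨$⟩ʳ y → x ≡ y
⟨$⟩ʳ-injective w e = trans (sym (inverseˡ w)) (trans (cong (w ⟨$⟩ˡ_) e) (inverseˡ w))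

flip-cong : (w v : Permutation′ n) → w ≈ₚ v → flip w ≈ₚ flip v
flip-cong w v w≈v j = begin
  w ⟨$⟩ˡ j                     ≡⟨ cong (w ⟨$⟩ˡ_) (sym (inverseʳ v)) ⟩
  w ⟨$⟩ˡ (v ⟨$⟩ʳ (v ⟨$⟩ˡ j))  ≡⟨ cong (w ⟨$⟩ˡ_) (sym (w≈v (v ⟨$⟩ˡ j))) ⟩
  w ⟨$⟩ˡ (w ⟨$⟩ʳ (v ⟨$⟩ˡ j))  ≡⟨ inverseˡ w ⟩
  v ⟨$⟩ˡ j                     ∎
  where open ≡-Reasoning

transpose-matchˡ : (i j : Fin n) → transpose i j ⟨$⟩ʳ i ≡ j
transpose-matchˡ i j rewrite dec-true (i Fin.≟ i) refl = refl

transpose-matchʳ : (i j : Fin n) → transpose i j ⟨$⟩ʳ j ≡ i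
transpose-matchʳ i j with j Fin.≟ i
... | yes refl = refl
... | no _ rewrite dec-true (j Fin.≟ j) refl = refl

transpose-mismatch : ∀ {i j k : Fin n} → k ≢ i → k ≢ j → transpose i j ⟨$⟩ʳ k ≡ k
transpose-mismatch {i = i} {j} {k} k≢i k≢j
  rewrite dec-false (k Fin.≟ i) k≢i | dec-false (k Fin.≟ j) k≢j = refl

transpose-involutive : (i j k : Fin n) → transpose i j ⟨$⟩ʳ (transpose i j ⟨$⟩ʳ k) ≡ k
transpose-involutive i j k = by-cases (k Fin.≟ i) (k Fin.≟ j)
  where
  τ = transpose i j
  by-cases : Dec (k ≡ i) → Dec (k ≡ j) → τ ⟨$⟩ʳ (τ ⟨$⟩ʳ k) ≡ k
  by-cases (yes refl) _ = trans (cong (τ ⟨$⟩ʳ_) (transpose-matchˡ i j)) (transpose-matchʳ i j)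
  by-cases (no _) (yes refl) = trans (cong (τ ⟨$⟩ʳ_) (transpose-matchʳ i j)) (transpose-matchˡ i j)
  by-cases (no k≢i) (no k≢j) =
    trans (cong (τ ⟨$⟩ʳ_) (transpose-mismatch k≢i k≢j)) (transpose-mismatch k≢i k≢j)

transpose-punchIn : (p : Fin n) (a : Fin n) →
  transpose (inject₁ p) (Fin.suc p) ⟨$⟩ʳ punchIn (Fin.suc p) a ≡ punchIn (inject₁ p) a
transpose-punchIn Fin.zero    Fin.zero    = refl
transpose-punchIn Fin.zero    (Fin.suc a) = refl
transpose-punchIn (Fin.suc p) Fin.zero    = refl
transpose-punchIn (Fin.suc p) (Fin.suc a) =
  trans (Perm.lift₀-transpose (inject₁ p) (Fin.suc p) (Fin.suc (punchIn (Fin.suc p) a)))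
        (cong Fin.suc (transpose-punchIn p a))

FixesFrom : ℕ → Permutation′ n → Set
FixesFrom r u = ∀ j → r ℕ.≤ toℕ j → u ⟨$⟩ʳ j ≡ j

fixesFrom-pred : (u : Permutation′ n) (i : Fin n) →
  FixesFrom (suc (toℕ i)) u → u ⟨$⟩ʳ i ≡ i → FixesFrom (toℕ i) u
fixesFrom-pred u i fix ui≡i j i≤j with toℕ i ℕ.≟ toℕ j
... | yes i≡j rewrite Fin.toℕ-injective i≡j = ui≡i
... | no i≢j = fix j (ℕ.≤∧≢⇒< i≤j i≢j)

-- Increasing maps between finite sets

Increasing : (Fin m → Fin n) → Set
Increasing f = ∀ a b → a Fin.< b → f a Fin.< f b

punchIn-increasing : (p : Fin (suc n)) → Increasing (punchIn p)
punchIn-increasing p a b a<b =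
  ℕ.≰⇒> (λ pb≤pa → ℕ.<⇒≱ a<b (Fin.punchIn-cancel-≤ p b a pb≤pa))

no-increasing-into-smaller : (h : Fin (suc n) → Fin n) → ¬ Increasing h
no-increasing-into-smaller h h↑ with Fin.pigeonhole ℕ.≤-refl h
... | i , j , i<j , hi≡hj = ℕ.<-irrefl (cong toℕ hi≡hj) (h↑ i j i<j)

private
  decrement : (f : Fin m → Fin (suc n)) → (∀ a → Fin.zero ≢ f a) → Fin m → Fin n
  decrement f nz a = punchOut (nz a)

  suc-decrement : ∀ (f : Fin m → Fin (suc n)) nz a → Fin.suc (decrement f nz a) ≡ f a
  suc-decrement f nz a = Fin.punchIn-punchOut (nz a)

  decrement-increasing : ∀ (f : Fin m → Fin (suc n)) nz → Increasing f → Increasing (decrement f nz)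
  decrement-increasing f nz f↑ a b a<b =
    ℕ.≰⇒> (λ fb≤fa → ℕ.<⇒≱ (f↑ a b a<b) (Fin.punchOut-cancel-≤ (nz b) (nz a) fb≤fa))

  tail-increasing : (f : Fin (suc m) → Fin n) → Increasing f → Increasing (f ∘ Fin.suc)
  tail-increasing f f↑ a b a<b = f↑ (Fin.suc a) (Fin.suc b) (s≤s a<b)

  zero≢tail : (f : Fin (suc m) → Fin (suc n)) → Increasing f → ∀ a → Fin.zero ≢ f (Fin.suc a)
  zero≢tail f f↑ a 0≡f = ℕ.n≮0 (subst (λ x → toℕ (f Fin.zero) ℕ.< toℕ x) (sym 0≡f)
                                         (f↑ Fin.zero (Fin.suc a) (s≤s z≤n)))

  zero≢all : (f : Fin (suc m) → Fin (suc n)) → Increasing f → f Fin.zero ≢ Fin.zero →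
             ∀ a → Fin.zero ≢ f a
  zero≢all f f↑ f0≢0 Fin.zero    = f0≢0 ∘ sym
  zero≢all f f↑ f0≢0 (Fin.suc a) = zero≢tail f f↑ a

increasing-endo⇒id : (g : Fin n → Fin n) → Increasing g → ∀ a → g a ≡ a
increasing-endo⇒id {suc n} g g↑ a with g Fin.zero Fin.≟ Fin.zero
... | no g0≢0 = ⊥-elim (no-increasing-into-smaller (decrement g nz) (decrement-increasing g nz g↑))
  where nz = zero≢all g g↑ g0≢0
increasing-endo⇒id {suc n} g g↑ Fin.zero    | yes g0≡0 = g0≡0
increasing-endo⇒id {suc n} g g↑ (Fin.suc a) | yes _    =
  trans (sym (suc-decrement (g ∘ Fin.suc) nz a))
        (cong Fin.suc (increasing-endo⇒id (decrement (g ∘ Fin.suc) nz)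
                         (decrement-increasing (g ∘ Fin.suc) nz (tail-increasing g g↑)) a))
  where nz = zero≢tail g g↑

increasing⇒punchIn : (f : Fin m → Fin (suc m)) → Increasing f → ∃[ p ] (∀ a → f a ≡ punchIn p a)
increasing⇒punchIn {zero}  f f↑ = Fin.zero , λ ()
increasing⇒punchIn {suc m} f f↑ with f Fin.zero Fin.≟ Fin.zero
... | no f0≢0 = Fin.zero , λ a →
  trans (sym (suc-decrement f nz a))
        (cong Fin.suc (increasing-endo⇒id (decrement f nz) (decrement-increasing f nz f↑) a))
  where nz = zero≢all f f↑ f0≢0
... | yes f0≡0 = Fin.suc (proj₁ tail≗punchIn) , λ where
    Fin.zero    → f0≡0
    (Fin.suc a) → trans (sym (suc-decrement (f ∘ Fin.suc) nz a)) (cong Fin.suc (proj₂ tail≗punchIn a))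
  where
  nz = zero≢tail f f↑
  tail≗punchIn = increasing⇒punchIn (decrement (f ∘ Fin.suc) nz)
                   (decrement-increasing (f ∘ Fin.suc) nz (tail-increasing f f↑))

-- move p q sends p to q and keeps the order of all other points: for q ≤ p it is the
-- consecutive cycle c_{q+1,p-q+1} of the paper, for p ≤ q the inverse of c_{p+1,q-p+1}.
move : Fin (suc n) → Fin (suc n) → Permutation′ (suc n)
move p q = insert p q Perm.id

move-punchIn : (p q : Fin (suc n)) (a : Fin n) → move p q ⟨$⟩ʳ punchIn p a ≡ punchIn q a
move-punchIn p q = Perm.insert-punchIn p q Perm.id

move-source : (p q : Fin (suc n)) → move p q ⟨$⟩ʳ p ≡ q
move-source p q with p Fin.≟ p
... | yes _   = refl
... | no p≢p = contradiction refl p≢p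

flip-move : (p q : Fin (suc n)) → flip (move p q) ≈ₚ move q p
flip-move p q j with q Fin.≟ j
... | yes _ = refl
... | no _  = refl

≈-move : (w : Permutation′ (suc n)) (p q : Fin (suc n)) →
         (∀ a → w ⟨$⟩ʳ punchIn p a ≡ punchIn q a) → w ≈ₚ move p q
≈-move w p q w∘punchIn j = by-cases (p Fin.≟ j)
  where
  open ≡-Reasoning
  wp≡q : w ⟨$⟩ʳ p ≡ q
  wp≡q with q Fin.≟ w ⟨$⟩ʳ p
  ... | yes q≡wp = sym q≡wp
  ... | no q≢wp = contradiction
    (⟨$⟩ʳ-injective w (trans (w∘punchIn (punchOut q≢wp)) (Fin.punchIn-punchOut q≢wp)))
    (Fin.punchInᵢ≢i p (punchOut q≢wp))
  by-cases : Dec (p ≡ j) → w ⟨$⟩ʳ j ≡ move p q ⟨$⟩ʳ j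
  by-cases (yes refl) = trans wp≡q (sym (move-source p q))
  by-cases (no p≢j) = begin
    w ⟨$⟩ʳ j                               ≡⟨ cong (w ⟨$⟩ʳ_) (sym (Fin.punchIn-punchOut p≢j)) ⟩
    w ⟨$⟩ʳ punchIn p (punchOut p≢j)         ≡⟨ w∘punchIn (punchOut p≢j) ⟩
    punchIn q (punchOut p≢j)                ≡⟨ sym (move-punchIn p q (punchOut p≢j)) ⟩
    move p q ⟨$⟩ʳ punchIn p (punchOut p≢j)  ≡⟨ cong (move p q ⟨$⟩ʳ_) (Fin.punchIn-punchOut p≢j) ⟩
    move p q ⟨$⟩ʳ j                         ∎

move-diag : (p : Fin (suc n)) (j : Fin (suc n)) → move p p ⟨$⟩ʳ j ≡ j
move-diag p j = sym (≈-move Perm.id p p (λ _ → refl) j)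

≈-flip-move : (w : Permutation′ (suc n)) (p q : Fin (suc n)) → flip w ≈ₚ move p q → w ≈ₚ move q p
≈-flip-move w p q w⁻¹≈ j = trans (flip-cong (flip w) (move p q) w⁻¹≈ j) (flip-move p q j)

move-adjacent : (p : Fin n) (q : Fin (suc n)) →
  transpose (inject₁ p) (Fin.suc p) ∘ₚ move (inject₁ p) q ≈ₚ move (Fin.suc p) q
move-adjacent p q =
  ≈-move (transpose (inject₁ p) (Fin.suc p) ∘ₚ move (inject₁ p) q) (Fin.suc p) q λ a →
    trans (cong (move (inject₁ p) q ⟨$⟩ʳ_) (transpose-punchIn p a)) (move-punchIn (inject₁ p) q a)

move-adjacent-comm : (p : Fin n) → move (inject₁ p) (Fin.suc p) ≈ₚ move (Fin.suc p) (inject₁ p)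
move-adjacent-comm p j = trans (move-c-c⁺≈τ j) (sym (move-c⁺-c≈τ j))
  where
  c = inject₁ p
  c⁺ = Fin.suc p
  τ = transpose c c⁺
  move-c⁺-c≈τ : ∀ j → move c⁺ c ⟨$⟩ʳ j ≡ τ ⟨$⟩ʳ j
  move-c⁺-c≈τ j = trans (sym (move-adjacent p c j)) (move-diag c (τ ⟨$⟩ʳ j))
  move-c-c⁺≈τ : ∀ j → move c c⁺ ⟨$⟩ʳ j ≡ τ ⟨$⟩ʳ j
  move-c-c⁺≈τ j = begin
    move c c⁺ ⟨$⟩ʳ j                    ≡⟨ cong (move c c⁺ ⟨$⟩ʳ_) (sym (transpose-involutive c c⁺ j)) ⟩
    move c c⁺ ⟨$⟩ʳ (τ ⟨$⟩ʳ (τ ⟨$⟩ʳ j))  ≡⟨ move-adjacent p c⁺ (τ ⟨$⟩ʳ j) ⟩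
    move c⁺ c⁺ ⟨$⟩ʳ (τ ⟨$⟩ʳ j)          ≡⟨ move-diag c⁺ (τ ⟨$⟩ʳ j) ⟩
    τ ⟨$⟩ʳ j                            ∎
    where open ≡-Reasoning

-- Consecutive cycles

private
  ¬T⇒≡false : ∀ {b} → ¬ T b → b ≡ false
  ¬T⇒≡false {false} _ = refl
  ¬T⇒≡false {true} ¬t = contradiction tt ¬t

-- Below, l is the last point i + k - 1 of the cycle c_{i+1,k}.
cycℕ-below : ∀ {i k l j} → i ℕ.+ k ≡ suc l → j ℕ.< i → i ℕ.≤ l → cycℕ i k j ≡ j
cycℕ-below {i} {k} {l} {j} e j<i i≤l
  rewrite ¬T⇒≡false {i ≤ᵇ j} (ℕ.<⇒≱ j<i ∘ ℕ.≤ᵇ⇒≤ i j)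
        | e
        | ¬T⇒≡false {j ≡ᵇ l} (ℕ.<⇒≢ (ℕ.<-≤-trans j<i i≤l) ∘ ℕ.≡ᵇ⇒≡ j l) = refl

cycℕ-inside : ∀ {i k l j} → i ℕ.+ k ≡ suc l → i ℕ.≤ j → j ℕ.< l → cycℕ i k j ≡ suc j
cycℕ-inside {i} {k} {l} {j} e i≤j j<l
  rewrite e | Equivalence.to T-≡ (ℕ.≤⇒≤ᵇ i≤j) | Equivalence.to T-≡ (ℕ.<⇒<ᵇ (s≤s j<l)) = refl

cycℕ-last : ∀ {i k l} → i ℕ.+ k ≡ suc l → cycℕ i k l ≡ i
cycℕ-last {i} {k} {l} e
  rewrite e
        | ¬T⇒≡false {suc l <ᵇ suc l} (ℕ.<-irrefl refl ∘ ℕ.<ᵇ⇒< (suc l) (suc l))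
        | ∧-zeroʳ (i ≤ᵇ l)
        | Equivalence.to T-≡ (ℕ.≡⇒≡ᵇ l l refl) = refl

cycℕ-above : ∀ {i k l j} → i ℕ.+ k ≡ suc l → l ℕ.< j → cycℕ i k j ≡ j
cycℕ-above {i} {k} {l} {j} e l<j
  rewrite e
        | ¬T⇒≡false {suc j <ᵇ suc l} (ℕ.<-asym (s≤s l<j) ∘ ℕ.<ᵇ⇒< (suc j) (suc l))
        | ∧-zeroʳ (i ≤ᵇ j)
        | ¬T⇒≡false {j ≡ᵇ l} (ℕ.<⇒≢ l<j ∘ sym ∘ ℕ.≡ᵇ⇒≡ j l) = refl

m+[1+n∸m]≡1+n : ∀ {m n} → m ℕ.≤ n → m ℕ.+ suc (n ∸ m) ≡ suc n
m+[1+n∸m]≡1+n {m} m≤n = trans (ℕ.+-suc m _) (cong suc (ℕ.m+[n∸m]≡n m≤n))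

move-isCycle : (p q : Fin (suc n)) → q Fin.≤ p → IsCycle (move p q) (toℕ q) (suc (toℕ p ∸ toℕ q))
move-isCycle p q q≤p j = by-cases (p Fin.≟ j)
  where
  i = toℕ q
  k = suc (toℕ p ∸ toℕ q)
  e = m+[1+n∸m]≡1+n q≤p
  at-punchIn : ∀ a → toℕ (punchIn q a) ≡ cycℕ i k (toℕ (punchIn p a))
  at-punchIn a with punchIn-cases q a | punchIn-cases p a
  ... | inj₁ (a<q , eq) | inj₁ (_ , ep) rewrite eq | ep | Fin.toℕ-inject₁ a =
    sym (cycℕ-below {i} {k} e a<q q≤p)
  ... | inj₁ (a<q , _)  | inj₂ (p≤a , _) =
    contradiction (ℕ.<-≤-trans a<q (ℕ.≤-trans q≤p p≤a)) (ℕ.<-irrefl refl)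
  ... | inj₂ (q≤a , eq) | inj₁ (a<p , ep) rewrite eq | ep | Fin.toℕ-inject₁ a =
    sym (cycℕ-inside {i} {k} e q≤a a<p)
  ... | inj₂ (_ , eq)   | inj₂ (p≤a , ep) rewrite eq | ep =
    sym (cycℕ-above {i} {k} e (s≤s p≤a))
  by-cases : Dec (p ≡ j) → toℕ (move p q ⟨$⟩ʳ j) ≡ cycℕ i k (toℕ j)
  by-cases (yes refl) = trans (cong toℕ (move-source p q)) (sym (cycℕ-last {i} {k} e))
  by-cases (no p≢j) =
    subst (λ x → toℕ (move p q ⟨$⟩ʳ x) ≡ cycℕ i k (toℕ x)) (Fin.punchIn-punchOut p≢j)
          (trans (cong toℕ (move-punchIn p q (punchOut p≢j))) (at-punchIn (punchOut p≢j)))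

isCycle-unique : (w v : Permutation′ n) (i k : ℕ) → IsCycle w i k → IsCycle v i k → w ≈ₚ v
isCycle-unique w v i k w-cyc v-cyc j = Fin.toℕ-injective (trans (w-cyc j) (sym (v-cyc j)))

cycle-as-move : ∀ i l → i ℕ.+ suc l ℕ.≤ suc n → ∃₂ λ p q → IsCycle (move {n} p q) i (suc l)
cycle-as-move {n} i l i+k≤1+n = p , q , subst₂ (IsCycle (move p q)) toℕ-q length (move-isCycle p q q≤p)
  where
  i+l<1+n : i ℕ.+ l ℕ.< suc n
  i+l<1+n = subst (ℕ._≤ suc n) (ℕ.+-suc i l) i+k≤1+n
  p = fromℕ< i+l<1+n
  q = fromℕ< (ℕ.≤-<-trans (ℕ.m≤m+n i l) i+l<1+n)
  toℕ-p : toℕ p ≡ i ℕ.+ l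
  toℕ-p = Fin.toℕ-fromℕ< i+l<1+n
  toℕ-q : toℕ q ≡ i
  toℕ-q = Fin.toℕ-fromℕ< _
  q≤p : q Fin.≤ p
  q≤p = subst₂ ℕ._≤_ (sym toℕ-q) (sym toℕ-p) (ℕ.m≤m+n i l)
  length : suc (toℕ p ∸ toℕ q) ≡ suc l
  length = cong suc (trans (cong₂ _∸_ toℕ-p toℕ-q) (ℕ.m+n∸m≡n i l))

consecutiveCycle⇔move : (w : Permutation′ (suc n)) → IsConsecutiveCycle w ⇔ (∃₂ λ p q → w ≈ₚ move p q)
consecutiveCycle⇔move {n} w = mk⇔ to from
  where
  to : IsConsecutiveCycle w → ∃₂ λ p q → w ≈ₚ move p q
  to (i , suc l , _ , i+k≤n , inj₁ w-cyc) with cycle-as-move i l i+k≤n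
  ... | p , q , move-cyc = p , q , isCycle-unique w (move p q) i (suc l) w-cyc move-cyc
  to (i , suc l , _ , i+k≤n , inj₂ w⁻¹-cyc) with cycle-as-move i l i+k≤n
  ... | p , q , move-cyc =
    q , p , ≈-flip-move w p q (isCycle-unique (flip w) (move p q) i (suc l) w⁻¹-cyc move-cyc)
  from : (∃₂ λ p q → w ≈ₚ move p q) → IsConsecutiveCycle w
  from (p , q , w≈) with q Fin.≤? p
  ... | yes q≤p = toℕ q , suc (toℕ p ∸ toℕ q) , s≤s z≤n ,
                  subst (ℕ._≤ suc n) (sym (m+[1+n∸m]≡1+n q≤p)) (Fin.toℕ<n p) ,
                  inj₁ (λ j → trans (cong toℕ (w≈ j)) (move-isCycle p q q≤p j))
  ... | no q≰p = toℕ p , suc (toℕ q ∸ toℕ p) , s≤s z≤n ,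
                 subst (ℕ._≤ suc n) (sym (m+[1+n∸m]≡1+n p≤q)) (Fin.toℕ<n q) ,
                 inj₂ (λ j → trans (cong toℕ (w⁻¹≈ j)) (move-isCycle q p p≤q j))
    where
    p≤q = ℕ.<⇒≤ (ℕ.≰⇒> q≰p)
    w⁻¹≈ : flip w ≈ₚ move q p
    w⁻¹≈ j = trans (flip-cong w (move p q) w≈ j) (flip-move p q j)

increasing⇔move : (w : Permutation′ (suc n)) → HasIncreasingSubseq w n ⇔ (∃₂ λ p q → w ≈ₚ move p q)
increasing⇔move w = mk⇔ to from
  where
  to : HasIncreasingSubseq w _ → ∃₂ λ p q → w ≈ₚ move p q
  to (f , f↑ , wf↑) with increasing⇒punchIn f f↑ | increasing⇒punchIn (λ a → w ⟨$⟩ʳ f a) wf↑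
  ... | p , f≗ | q , wf≗ = p , q , ≈-move w p q (λ a → trans (cong (w ⟨$⟩ʳ_) (sym (f≗ a))) (wf≗ a))
  from : (∃₂ λ p q → w ≈ₚ move p q) → HasIncreasingSubseq w _
  from (p , q , w≈) = punchIn p , punchIn-increasing p , λ a b a<b →
    subst₂ (λ x y → x Fin.< y) (sym (w∘punchIn a)) (sym (w∘punchIn b)) (punchIn-increasing q a b a<b)
    where
    w∘punchIn : ∀ a → w ⟨$⟩ʳ punchIn p a ≡ punchIn q a
    w∘punchIn a = trans (w≈ (punchIn p a)) (move-punchIn p q a)

-- Triangularity of moves

dist : Fin n → Fin n → ℕ
dist p q = ∣ toℕ p - toℕ q ∣

dist-inject₁-suc : (a : Fin n) → dist (inject₁ a) (Fin.suc a) ≡ 1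
dist-inject₁-suc a rewrite Fin.toℕ-inject₁ a = ∣n-1+n∣≡1 (toℕ a)
  where
  ∣n-1+n∣≡1 : ∀ n → ∣ n - suc n ∣ ≡ 1
  ∣n-1+n∣≡1 zero    = refl
  ∣n-1+n∣≡1 (suc n) = ∣n-1+n∣≡1 n

dist-comm : (p q : Fin n) → dist p q ≡ dist q p
dist-comm p q = ℕ.∣-∣-comm (toℕ p) (toℕ q)

dist≤n : (p q : Fin (suc n)) → dist p q ℕ.≤ n
dist≤n p q = ℕ.≤-trans (ℕ.∣m-n∣≤m⊔n (toℕ p) (toℕ q)) (ℕ.⊔-lub (toℕ≤n p) (toℕ≤n q))
  where
  toℕ≤n : (i : Fin (suc n)) → toℕ i ℕ.≤ n
  toℕ≤n i = ℕ.≤-pred (Fin.toℕ<n i)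

private
  squeeze : ∀ {p q a} → q ℕ.≤ a → a ℕ.< p → ∣ p - q ∣ ℕ.≤ 1 → p ≡ suc a × q ≡ a
  squeeze {suc zero}    {zero} z≤n (s≤s z≤n) _ = refl , refl
  squeeze {suc (suc p)} {zero} _   _         (s≤s ())
  squeeze {suc p} {suc q} (s≤s q≤a) (s≤s a<p) d≤1 with squeeze q≤a a<p d≤1
  ... | p≡ , q≡ = cong suc p≡ , cong suc q≡

  straddle : (a : Fin n) (p q : Fin (suc n)) → q Fin.≤ a → a Fin.< p →
             (p ≡ Fin.suc a × q ≡ inject₁ a) ⊎ 1 ℕ.< dist p q
  straddle a p q q≤a a<p with 1 ℕ.<? dist p q
  ... | yes far = inj₂ far
  ... | no ¬far with squeeze q≤a a<p (ℕ.≮⇒≥ ¬far)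
  ...   | p≡ , q≡ = inj₁ (Fin.toℕ-injective p≡ , Fin.toℕ-injective (trans q≡ (sym (Fin.toℕ-inject₁ a))))

  move-triangular-diag : (p′ q′ x : Fin (suc n)) → move p′ q′ ≈ₚ move x x ⊎ dist x x ℕ.< dist p′ q′
  move-triangular-diag p′ q′ x with p′ Fin.≟ q′
  ... | yes refl = inj₁ (λ j → trans (move-diag p′ j) (sym (move-diag x j)))
  ... | no p′≢q′ rewrite ℕ.∣n-n∣≡0 (toℕ x) =
    inj₂ (ℕ.n≢0⇒n>0 (p′≢q′ ∘ Fin.toℕ-injective ∘ ℕ.∣m-n∣≡0⇒m≡n))

  move-triangular-punchIn : (p′ q′ : Fin (suc n)) (a : Fin n) →
    move p′ q′ ≈ₚ move (punchIn p′ a) (punchIn q′ a) ⊎ dist (punchIn p′ a) (punchIn q′ a) ℕ.< dist p′ q′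
  move-triangular-punchIn p′ q′ a with punchIn-cases p′ a | punchIn-cases q′ a
  ... | inj₁ (_ , ep) | inj₁ (_ , eq) rewrite ep | eq = move-triangular-diag p′ q′ (inject₁ a)
  ... | inj₂ (_ , ep) | inj₂ (_ , eq) rewrite ep | eq = move-triangular-diag p′ q′ (Fin.suc a)
  ... | inj₁ (a<p′ , ep) | inj₂ (q′≤a , eq) rewrite ep | eq with straddle a p′ q′ q′≤a a<p′
  ...   | inj₁ (refl , refl) = inj₁ (λ j → sym (move-adjacent-comm a j))
  ...   | inj₂ far = inj₂ (subst (ℕ._< dist p′ q′) (sym (dist-inject₁-suc a)) far)
  move-triangular-punchIn p′ q′ a | inj₂ (p′≤a , ep) | inj₁ (a<q′ , eq) rewrite ep | eq
    with straddle a q′ p′ p′≤a a<q′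
  ...   | inj₁ (refl , refl) = inj₁ (move-adjacent-comm a)
  ...   | inj₂ far = inj₂ (subst₂ ℕ._<_ (sym (trans (dist-comm (Fin.suc a) (inject₁ a)) (dist-inject₁-suc a)))
                                        (dist-comm q′ p′) far)

-- move p′ q′ shifts every point other than p′ by at most one place, so dist p q ≤ 1 if
-- p ≢ p′; and if also dist p′ q′ ≤ 1, both moves are the identity or the same adjacent
-- transposition.
move-triangular : (p q p′ q′ : Fin (suc n)) → move p′ q′ ⟨$⟩ʳ p ≡ q →
  move p′ q′ ≈ₚ move p q ⊎ dist p q ℕ.< dist p′ q′
move-triangular p q p′ q′ e = by-cases (p′ Fin.≟ p)
  where
  by-cases : Dec (p′ ≡ p) → move p′ q′ ≈ₚ move p q ⊎ dist p q ℕ.< dist p′ q′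
  by-cases (yes refl) = inj₁ (λ j → cong (λ r → move p r ⟨$⟩ʳ j) (trans (sym (move-source p q′)) e))
  by-cases (no p′≢p) =
    subst₂ (λ x y → move p′ q′ ≈ₚ move x y ⊎ dist x y ℕ.< dist p′ q′)
           (Fin.punchIn-punchOut p′≢p) punchIn≡q (move-triangular-punchIn p′ q′ (punchOut p′≢p))
    where
    punchIn≡q : punchIn q′ (punchOut p′≢p) ≡ q
    punchIn≡q = trans (sym (move-punchIn p′ q′ _))
                      (trans (cong (move p′ q′ ⟨$⟩ʳ_) (Fin.punchIn-punchOut p′≢p)) e)

module Matrices {r ℓ} (R : CommutativeRing r ℓ) where

  open CommutativeRing R
    renaming (refl to ≈-refl; sym to ≈-sym; trans to ≈-trans; reflexive to ≈-reflexive)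
  open RingProperties ring
    using (-1*x≈-x; -‿distribʳ-*; [y-z]x≈yx-zx; x[y-z]≈xy-xz; -0#≈0#; ⁻¹-anti-homo‿-; //-rightDividesˡ)
  open Lin R
  open import Relation.Binary.Reasoning.Setoid setoid

  x≈[x-y]+y : ∀ x y → x ≈ (x - y) + y
  x≈[x-y]+y x y = ≈-sym (//-rightDividesˡ y x)

  y≈x-[x-y] : ∀ x y → y ≈ x - (x - y)
  y≈x-[x-y] x y = begin
    y               ≈⟨ x≈[x-y]+y y x ⟩
    (y - x) + x     ≈⟨ +-comm (y - x) x ⟩
    x + (y - x)     ≈⟨ +-congˡ (⁻¹-anti-homo‿- x y) ⟨
    x - (x - y)     ∎

  x-y≈[x-z]-[y-z] : ∀ x y z → x - y ≈ (x - z) - (y - z)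
  x-y≈[x-z]-[y-z] x y z = begin
    x - y                   ≈⟨ +-congʳ (x≈[x-y]+y x z) ⟩
    ((x - z) + z) - y       ≈⟨ +-assoc (x - z) z (- y) ⟩
    (x - z) + (z - y)       ≈⟨ +-congˡ (⁻¹-anti-homo‿- y z) ⟨
    (x - z) - (y - z)       ∎

  δ : Fin n → Fin n → Carrier
  δ x a = if ⌊ x Fin.≟ a ⌋ then 1# else 0#

  δ-refl : (x : Fin n) → δ x x ≡ 1#
  δ-refl x with x Fin.≟ x
  ... | yes _   = refl
  ... | no x≢x = contradiction refl x≢x

  δ-≢ : {x a : Fin n} → x ≢ a → δ x a ≡ 0#
  δ-≢ {x = x} {a} x≢a with x Fin.≟ a
  ... | yes x≡a = contradiction x≡a x≢a
  ... | no _    = refl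

  δ⁻ : Fin n → Fin n → Fin n → Carrier
  δ⁻ a b x = δ x a - δ x b

  Δ : Fin n → Fin n → Fin n → Fin n → Matrix n
  Δ a b y y' x z = δ⁻ a b x * δ⁻ y y' z

  infixl 25 _⊖_
  _⊖_ : Matrix n → Matrix n → Matrix n
  (A ⊖ B) x y = A x y - B x y

  ≋-refl : {A : Matrix n} → A ≋ A
  ≋-refl _ _ = ≈-refl

  ≋-sym : {A B : Matrix n} → A ≋ B → B ≋ A
  ≋-sym A≋B x y = ≈-sym (A≋B x y)

  δ⁻-source : {a b : Fin n} → a ≢ b → δ⁻ a b a ≈ 1#
  δ⁻-source {a = a} a≢b rewrite δ-refl a | δ-≢ a≢b = ≈-trans (+-congˡ -0#≈0#) (+-identityʳ 1#)

  δ⁻-target : {a b : Fin n} → a ≢ b → δ⁻ a b b ≈ - 1#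
  δ⁻-target {b = b} a≢b rewrite δ-refl b | δ-≢ (a≢b ∘ sym) = +-identityˡ (- 1#)

  δ⁻-elsewhere : {a b x : Fin n} → x ≢ a → x ≢ b → δ⁻ a b x ≈ 0#
  δ⁻-elsewhere x≢a x≢b rewrite δ-≢ x≢a | δ-≢ x≢b = -‿inverseʳ 0#

  Δ-rowSplit : (a b z y y' : Fin n) → Δ a b y y' ≋ Δ a z y y' ⊖ Δ b z y y'
  Δ-rowSplit a b z y y' x x' =
    ≈-trans (*-congʳ (x-y≈[x-z]-[y-z] (δ x a) (δ x b) (δ x z))) ([y-z]x≈yx-zx _ _ _)

  Δ-colSplit : (a b y y' z : Fin n) → Δ a b y y' ≋ Δ a b y z ⊖ Δ a b y' z
  Δ-colSplit a b y y' z x x' =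
    ≈-trans (*-congˡ (x-y≈[x-z]-[y-z] (δ x' y) (δ x' y') (δ x' z))) (x[y-z]≈xy-xz _ _ _)

  Δ-colDiag : (a b y : Fin n) → Δ a b y y ≋ 0M
  Δ-colDiag a b y x x' = ≈-trans (*-congˡ (-‿inverseʳ (δ x' y))) (zeroʳ _)

  module _ {S : MSet n} where

    span-gen : ∀ {M} → S M → Span S M
    span-gen {M} s = (1# , M) ∷ [] , s ∷ [] , λ x y → ≈-trans (+-identityʳ _) (*-identityˡ _)

    span-≋ : ∀ {A B} → A ≋ B → Span S A → Span S B
    span-≋ A≋B (xs , s , e) = xs , s , λ x y → ≈-trans (e x y) (A≋B x y)

    span-0M : Span S 0M
    span-0M = [] , [] , λ _ _ → ≈-refl

    lincomb-++ : ∀ xs ys (x y : Fin n) → lincomb (xs ++ ys) x y ≈ lincomb xs x y + lincomb ys x y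
    lincomb-++ []       ys x y = ≈-sym (+-identityˡ _)
    lincomb-++ (z ∷ xs) ys x y = ≈-trans (+-congˡ (lincomb-++ xs ys x y)) (≈-sym (+-assoc _ _ _))

    span-⊕ : ∀ {A B} → Span S A → Span S B → Span S (A ⊕ B)
    span-⊕ (xs , s , e) (ys , t , f) =
      xs ++ ys , All.++⁺ s t , λ x y → ≈-trans (lincomb-++ xs ys x y) (+-cong (e x y) (f x y))

    lincomb-scale : ∀ a xs (x y : Fin n) →
                    lincomb (map (λ z → a * proj₁ z , proj₂ z) xs) x y ≈ a * lincomb xs x y
    lincomb-scale a []       x y = ≈-sym (zeroʳ a)
    lincomb-scale a (z ∷ xs) x y =
      ≈-trans (+-cong (*-assoc _ _ _) (lincomb-scale a xs x y)) (≈-sym (distribˡ _ _ _))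

    span-⊙ : ∀ {A} a → Span S A → Span S (a ⊙ A)
    span-⊙ a (xs , s , e) =
      map (λ z → a * proj₁ z , proj₂ z) xs , All.map⁺ s ,
      λ x y → ≈-trans (lincomb-scale a xs x y) (*-congˡ (e x y))

    span-⊖ : ∀ {A B} → Span S A → Span S B → Span S (A ⊖ B)
    span-⊖ A∈ B∈ = span-≋ (λ x y → +-congˡ (-1*x≈-x _)) (span-⊕ A∈ (span-⊙ (- 1#) B∈))

    span-cancelʳ : ∀ {A B} → Span S (A ⊖ B) → Span S B → Span S A
    span-cancelʳ A-B∈ B∈ = span-≋ (λ x y → ≈-sym (x≈[x-y]+y _ _)) (span-⊕ A-B∈ B∈)

    span-cancelˡ : ∀ {A B} → Span S A → Span S (A ⊖ B) → Span S B
    span-cancelˡ A∈ A-B∈ = span-≋ (λ x y → ≈-sym (y≈x-[x-y] _ _)) (span-⊖ A∈ A-B∈)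

    span-lincomb : ∀ xs → All (λ z → Span S (proj₂ z)) xs → Span S (lincomb xs)
    span-lincomb []       []         = span-0M
    span-lincomb (z ∷ xs) (z∈ ∷ xs∈) = span-⊕ (span-⊙ (proj₁ z) z∈) (span-lincomb xs xs∈)

  P-cong : (w v : Permutation′ n) → w ≈ₚ v → P w ≋ P v
  P-cong w v w≈v x y = ≈-reflexive (cong (δ x) (w≈v y))

  exchange : (u : Permutation′ n) {y₁ y₂ : Fin n} → y₁ ≢ y₂ →
             P u ⊖ P (transpose y₁ y₂ ∘ₚ u) ≋ Δ (u ⟨$⟩ʳ y₁) (u ⟨$⟩ʳ y₂) y₁ y₂
  exchange u {y₁} {y₂} y₁≢y₂ x z = by-cases (z Fin.≟ y₁) (z Fin.≟ y₂)
    where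
    τ = transpose y₁ y₂
    col : Fin _ → Carrier
    col t = δ x (u ⟨$⟩ʳ t)
    D = col y₁ - col y₂
    by-cases : Dec (z ≡ y₁) → Dec (z ≡ y₂) → col z - col (τ ⟨$⟩ʳ z) ≈ D * δ⁻ y₁ y₂ z
    by-cases (yes refl) _ = begin
      col y₁ - col (τ ⟨$⟩ʳ y₁)  ≡⟨ cong (λ t → col y₁ - col t) (transpose-matchˡ y₁ y₂) ⟩
      D                         ≈⟨ *-identityʳ D ⟨
      D * 1#                    ≈⟨ *-congˡ (δ⁻-source y₁≢y₂) ⟨
      D * δ⁻ y₁ y₂ y₁           ∎
    by-cases (no _) (yes refl) = begin
      col y₂ - col (τ ⟨$⟩ʳ y₂)  ≡⟨ cong (λ t → col y₂ - col t) (transpose-matchʳ y₁ y₂) ⟩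
      col y₂ - col y₁           ≈⟨ ⁻¹-anti-homo‿- (col y₁) (col y₂) ⟨
      - D                       ≈⟨ -‿cong (*-identityʳ D) ⟨
      - (D * 1#)                ≈⟨ -‿distribʳ-* D 1# ⟩
      D * - 1#                  ≈⟨ *-congˡ (δ⁻-target y₁≢y₂) ⟨
      D * δ⁻ y₁ y₂ y₂           ∎
    by-cases (no z≢y₁) (no z≢y₂) = begin
      col z - col (τ ⟨$⟩ʳ z)    ≡⟨ cong (λ t → col z - col t) (transpose-mismatch z≢y₁ z≢y₂) ⟩
      col z - col z             ≈⟨ -‿inverseʳ (col z) ⟩
      0#                        ≈⟨ zeroʳ D ⟨
      D * 0#                    ≈⟨ *-congˡ (δ⁻-elsewhere z≢y₁ z≢y₂) ⟨
      D * δ⁻ y₁ y₂ z            ∎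

  -- Spanning

  move∈cycles : (p q : Fin (suc n)) → CycleMatrices (P (move p q))
  move∈cycles p q =
    lift (move p q , Equivalence.from (consecutiveCycle⇔move (move p q)) (p , q , λ _ → refl) , ≋-refl)

  Δ-punchIn∈span : (q : Fin (suc n)) (p : Fin n) →
    Span CycleMatrices (Δ q (punchIn q p) (inject₁ p) (Fin.suc p))
  Δ-punchIn∈span q p = span-≋ difference
    (span-⊖ (span-gen (move∈cycles c q)) (span-gen (move∈cycles c⁺ q)))
    where
    c = inject₁ p
    c⁺ = Fin.suc p
    c⁺≡punchIn : c⁺ ≡ punchIn c p
    c⁺≡punchIn = sym (punchIn-inject₁ p)
    c≢c⁺ : c ≢ c⁺
    c≢c⁺ = Fin.punchInᵢ≢i c p ∘ trans (sym c⁺≡punchIn) ∘ sym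
    move-c⁺ : move c q ⟨$⟩ʳ c⁺ ≡ punchIn q p
    move-c⁺ = trans (cong (move c q ⟨$⟩ʳ_) c⁺≡punchIn) (move-punchIn c q p)
    adjacent : P (transpose c c⁺ ∘ₚ move c q) ≋ P (move c⁺ q)
    adjacent = P-cong (transpose c c⁺ ∘ₚ move c q) (move c⁺ q) (move-adjacent p q)
    difference : P (move c q) ⊖ P (move c⁺ q) ≋ Δ q (punchIn q p) c c⁺
    difference x y = begin
      (P (move c q) ⊖ P (move c⁺ q)) x y                   ≈⟨ +-congˡ (-‿cong (adjacent x y)) ⟨
      (P (move c q) ⊖ P (transpose c c⁺ ∘ₚ move c q)) x y  ≈⟨ exchange (move c q) c≢c⁺ x y ⟩
      Δ (move c q ⟨$⟩ʳ c) (move c q ⟨$⟩ʳ c⁺) c c⁺ x y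
        ≡⟨ cong₂ (λ a b → Δ a b c c⁺ x y) (move-source c q) move-c⁺ ⟩
      Δ q (punchIn q p) c c⁺ x y                          ∎

  Δ-adjacentCols∈span : (a b : Fin (suc n)) (p : Fin n) →
    Span CycleMatrices (Δ a b (inject₁ p) (Fin.suc p))
  Δ-adjacentCols∈span a b p =
    span-≋ (≋-sym (Δ-rowSplit a b c c c⁺)) (span-⊖ (into-c a) (into-c b))
    where
    c = inject₁ p
    c⁺ = Fin.suc p
    into-c : ∀ x → Span CycleMatrices (Δ x c c c⁺)
    into-c x with punchIn-cases x p
    ... | inj₁ (_ , x→c) = subst (λ t → Span CycleMatrices (Δ x t c c⁺)) x→c (Δ-punchIn∈span x p)
    ... | inj₂ (_ , x→c⁺) = span-≋ (≋-sym (Δ-rowSplit x c c⁺ c c⁺))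
      (span-⊖
        (subst (λ t → Span CycleMatrices (Δ x t c c⁺)) x→c⁺ (Δ-punchIn∈span x p))
        (subst (λ t → Span CycleMatrices (Δ c t c c⁺)) (punchIn-inject₁ p) (Δ-punchIn∈span c p)))

  Δ∈span : (a b y y' : Fin (suc n)) → Span CycleMatrices (Δ a b y y')
  Δ∈span {n} a b y y' =
    span-≋ (≋-sym (Δ-colSplit a b y y' Fin.zero)) (span-⊖ (into-0 y) (into-0 y'))
    where
    into-0 : ∀ y → Span CycleMatrices (Δ a b y Fin.zero)
    into-0 = <-weakInduction (λ y → Span CycleMatrices (Δ a b y Fin.zero))
      (span-≋ (≋-sym (Δ-colDiag a b Fin.zero)) span-0M)
      (λ p c∈ → span-cancelˡ c∈
        (span-≋ (Δ-colSplit a b (inject₁ p) (Fin.suc p) Fin.zero) (Δ-adjacentCols∈span a b p)))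

  -- If u fixes every point beyond i, composing it with the transposition of i and u⁻¹ i
  -- fixes i as well and changes P u by a rank-one Δ.
  perm∈span : (u : Permutation′ (suc n)) → Span CycleMatrices (P u)
  perm∈span {n} u = <-weakInduction Claim base step (Fin.fromℕ (suc n)) u fixesFrom-top
    where
    Claim : Fin (suc (suc n)) → Set _
    Claim i = ∀ u → FixesFrom (toℕ i) u → Span CycleMatrices (P u)
    fixesFrom-top : FixesFrom (toℕ (Fin.fromℕ (suc n))) u
    fixesFrom-top j n<j rewrite Fin.toℕ-fromℕ (suc n) = contradiction (Fin.toℕ<n j) (ℕ.≤⇒≯ n<j)
    base : Claim Fin.zero
    base u fix = span-≋ (P-cong (move Fin.zero Fin.zero) u u≈id) (span-gen (move∈cycles Fin.zero Fin.zero))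
      where u≈id = λ j → trans (move-diag Fin.zero j) (sym (fix j z≤n))
    step : ∀ i → Claim (inject₁ i) → Claim (Fin.suc i)
    step i IH u fix = by-cases (u ⟨$⟩ʳ i Fin.≟ i)
      where
      IH′ : ∀ w → FixesFrom (toℕ i) w → Span CycleMatrices (P w)
      IH′ w = IH w ∘ subst (λ r → FixesFrom r w) (sym (Fin.toℕ-inject₁ i))
      by-cases : Dec (u ⟨$⟩ʳ i ≡ i) → Span CycleMatrices (P u)
      by-cases (yes ui≡i) = IH′ u (fixesFrom-pred u i fix ui≡i)
      by-cases (no ui≢i) = span-cancelʳ
        (span-≋ (≋-sym (exchange u i≢t)) (Δ∈span _ _ i t))
        (IH′ v (fixesFrom-pred v i fixv vi≡i))
        where
        t = u ⟨$⟩ˡ i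
        v = transpose i t ∘ₚ u
        i≢t : i ≢ t
        i≢t i≡t = ui≢i (trans (cong (u ⟨$⟩ʳ_) i≡t) (inverseʳ u))
        vi≡i : v ⟨$⟩ʳ i ≡ i
        vi≡i = trans (cong (u ⟨$⟩ʳ_) (transpose-matchˡ i t)) (inverseʳ u)
        fixv : FixesFrom (suc (toℕ i)) v
        fixv j i<j = trans (cong (u ⟨$⟩ʳ_) (transpose-mismatch j≢i j≢t)) (fix j i<j)
          where
          j≢i : j ≢ i
          j≢i j≡i = ℕ.<-irrefl (cong toℕ (sym j≡i)) i<j
          j≢t : j ≢ t
          j≢t j≡t = j≢i (trans (sym (fix j i<j)) (trans (cong (u ⟨$⟩ʳ_) j≡t) (inverseʳ u)))

  -- CycleMatricesAfter Perm.id and CycleMatricesAfter w₀ are CycleMatrices and CycleW₀Matrices.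
  CycleMatricesAfter : Permutation′ n → MSet n
  CycleMatricesAfter σ M = Lift (r ⊔ ℓ) (∃[ w ] (IsConsecutiveCycle w × (P (σ ∘ₚ w) ≋ M)))

  permuteColumns : Permutation′ n → Matrix n → Matrix n
  permuteColumns σ M x y = M x (σ ⟨$⟩ʳ y)

  lincomb-permuteColumns : (σ : Permutation′ n) (xs : List (Carrier × Matrix n)) (x y : Fin n) →
    lincomb (map (map₂ (permuteColumns σ)) xs) x y ≡ lincomb xs x (σ ⟨$⟩ʳ y)
  lincomb-permuteColumns σ []       x y = refl
  lincomb-permuteColumns σ (z ∷ xs) x y =
    cong (proj₁ z * proj₂ z x (σ ⟨$⟩ʳ y) +_) (lincomb-permuteColumns σ xs x y)

  span-permuteColumns : (σ : Permutation′ n) {M : Matrix n} →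
    Span CycleMatrices M → Span (CycleMatricesAfter σ) (permuteColumns σ M)
  span-permuteColumns σ (xs , cycles , e) =
    map (map₂ (permuteColumns σ)) xs ,
    All.map⁺ (All.map (λ { (lift (w , cc , P≋)) → lift (w , cc , λ x y → P≋ x (σ ⟨$⟩ʳ y)) }) cycles) ,
    λ x y → ≈-trans (≈-reflexive (lincomb-permuteColumns σ xs x y)) (e x (σ ⟨$⟩ʳ y))

  perm∈spanAfter : (σ u : Permutation′ (suc n)) → Span (CycleMatricesAfter σ) (P u)
  perm∈spanAfter σ u = span-≋
    (λ x y → ≈-reflexive (cong (λ t → δ x (u ⟨$⟩ʳ t)) (inverseˡ σ)))
    (span-permuteColumns σ (perm∈span (flip σ ∘ₚ u)))

  -- Linear independence

  record Triangular (S : MSet n) : Set (r ⊔ ℓ) where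
    field
      rank       : ∀ {M} → S M → ℕ
      rankBound  : ℕ
      rank<bound : ∀ {M} (s : S M) → rank s ℕ.< rankBound
      pivotRow   : ∀ {M} → S M → Fin n
      pivotCol   : ∀ {M} → S M → Fin n
      pivot≈1    : ∀ {M} (s : S M) → M (pivotRow s) (pivotCol s) ≈ 1#
      pivot-triangular : ∀ {M M′} (s : S M) (s′ : S M′) → ¬ (M ≋ M′) →
                         M′ (pivotRow s) (pivotCol s) ≈ 0# ⊎ rank s ℕ.< rank s′

  private
    Distinct : Carrier × Matrix n → Carrier × Matrix n → Set ℓ
    Distinct z z′ = ¬ (proj₂ z ≋ proj₂ z′)

    term : Fin n → Fin n → Carrier × Matrix n → Carrier
    term x y z = proj₁ z * proj₂ z x y

  lincomb-vanishing : ∀ (xs : List (Carrier × Matrix n)) x y →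
    (∀ {z} → z ∈ xs → term x y z ≈ 0#) → lincomb xs x y ≈ 0#
  lincomb-vanishing []       x y _        = ≈-refl
  lincomb-vanishing (z ∷ xs) x y vanish =
    ≈-trans (+-cong (vanish (here refl)) (lincomb-vanishing xs x y (vanish ∘ there))) (+-identityʳ 0#)

  lincomb-single : ∀ {xs : List (Carrier × Matrix n)} {z} x y → AllPairs Distinct xs → z ∈ xs →
    (∀ {z′} → z′ ∈ xs → Distinct z z′ → term x y z′ ≈ 0#) → lincomb xs x y ≈ term x y z
  lincomb-single {xs = z ∷ xs} x y (z≉ ∷ _) (here refl) others =
    ≈-trans (+-congˡ (lincomb-vanishing xs x y (λ z′∈ → others (there z′∈) (All.lookup z≉ z′∈))))
            (+-identityʳ _)
  lincomb-single x y (z₀≉ ∷ distinct) (there z∈) others =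
    ≈-trans (+-congʳ (others (here refl) (All.lookup z₀≉ z∈ ∘ ≋-sym)))
            (≈-trans (+-identityˡ _) (lincomb-single x y distinct z∈ (others ∘ there)))

  -- Downward induction on the rank: at the pivot of a member of rank d, all
  -- other members vanish or have larger rank, hence a zero coefficient.
  triangular⇒linIndep : {S : MSet n} → Triangular S → LinIndep S
  triangular⇒linIndep {n} {S} T xs members distinct lincomb≋0 =
    All.tabulate (λ z∈ → vanishes rankBound 0 refl z∈ z≤n)
    where
    open Triangular T
    rankOf : ∀ {z} → z ∈ xs → ℕ
    rankOf z∈ = rank (All.lookup members z∈)
    Vanishes : ℕ → Set _
    Vanishes d = ∀ {z} (z∈ : z ∈ xs) → d ℕ.≤ rankOf z∈ → proj₁ z ≈ 0#
    step : ∀ d → Vanishes (suc d) → Vanishes d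
    step d above {z} z∈ d≤rank = begin
      proj₁ z                ≈⟨ *-identityʳ (proj₁ z) ⟨
      proj₁ z * 1#           ≈⟨ *-congˡ (pivot≈1 s) ⟨
      term x y z             ≈⟨ lincomb-single x y distinct z∈ others ⟨
      lincomb xs x y         ≈⟨ lincomb≋0 x y ⟩
      0#                     ∎
      where
      s = All.lookup members z∈
      x = pivotRow s
      y = pivotCol s
      others : ∀ {z′} → z′ ∈ xs → Distinct z z′ → term x y z′ ≈ 0#
      others z′∈ z≉z′ with pivot-triangular s (All.lookup members z′∈) z≉z′
      ... | inj₁ entry≈0 = ≈-trans (*-congˡ entry≈0) (zeroʳ _)
      ... | inj₂ rank<   = ≈-trans (*-congʳ (above z′∈ (ℕ.≤-<-trans d≤rank rank<))) (zeroˡ _)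
    vanishes : ∀ k d → d ℕ.+ k ≡ rankBound → Vanishes d
    vanishes zero d d≡bound z∈ d≤rank =
      contradiction (subst (ℕ._≤ rankOf z∈) (trans (sym (ℕ.+-identityʳ d)) d≡bound) d≤rank)
                    (ℕ.<⇒≱ (rank<bound (All.lookup members z∈)))
    vanishes (suc k) d d+k≡bound = step d (vanishes k (suc d) (trans (sym (ℕ.+-suc d k)) d+k≡bound))

  module _ (σ : Permutation′ (suc n)) where

    asMove : ∀ {M} → CycleMatricesAfter σ M → ∃₂ λ p q → P (σ ∘ₚ move p q) ≋ M
    asMove (lift (w , cc , P≋)) with Equivalence.to (consecutiveCycle⇔move w) cc
    ... | p , q , w≈ = p , q , λ x y →
      ≈-trans (P-cong (σ ∘ₚ move p q) (σ ∘ₚ w) (λ j → sym (w≈ (σ ⟨$⟩ʳ j))) x y) (P≋ x y)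

    private
      source target : ∀ {M} → CycleMatricesAfter σ M → Fin (suc n)
      source s = proj₁ (asMove s)
      target s = proj₁ (proj₂ (asMove s))

      asMove-≋ : ∀ {M} (s : CycleMatricesAfter σ M) → P (σ ∘ₚ move (source s) (target s)) ≋ M
      asMove-≋ s = proj₂ (proj₂ (asMove s))

      entry : ∀ {M} (s : CycleMatricesAfter σ M) (x p : Fin (suc n)) →
              M x (σ ⟨$⟩ˡ p) ≈ δ x (move (source s) (target s) ⟨$⟩ʳ p)
      entry s x p = ≈-trans (≈-sym (asMove-≋ s x (σ ⟨$⟩ˡ p)))
        (≈-reflexive (cong (λ t → δ x (move (source s) (target s) ⟨$⟩ʳ t)) (inverseʳ σ)))

      pivot≈1 : ∀ {M} (s : CycleMatricesAfter σ M) → M (target s) (σ ⟨$⟩ˡ source s) ≈ 1#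
      pivot≈1 s = ≈-trans (entry s (target s) (source s)) (≈-reflexive
        (trans (cong (δ (target s)) (move-source (source s) (target s))) (δ-refl (target s))))

      pivot-triangular : ∀ {M M′} (s : CycleMatricesAfter σ M) (s′ : CycleMatricesAfter σ M′) →
        ¬ (M ≋ M′) → M′ (target s) (σ ⟨$⟩ˡ source s) ≈ 0#
                     ⊎ dist (source s) (target s) ℕ.< dist (source s′) (target s′)
      pivot-triangular {M} {M′} s s′ M≉M′ with move (source s′) (target s′) ⟨$⟩ʳ source s Fin.≟ target s
      ... | no ≢target = inj₁ (≈-trans (entry s′ (target s) (source s)) (≈-reflexive (δ-≢ (≢target ∘ sym))))
      ... | yes ≡target with move-triangular (source s) (target s) (source s′) (target s′) ≡target
      ...   | inj₂ closer = inj₂ closer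
      ...   | inj₁ same = contradiction M≋M′ M≉M′
        where
        M≋M′ : M ≋ M′
        M≋M′ x y = ≈-trans (≈-sym (asMove-≋ s x y)) (≈-trans
          (P-cong (σ ∘ₚ move (source s) (target s)) (σ ∘ₚ move (source s′) (target s′))
                  (λ j → sym (same (σ ⟨$⟩ʳ j))) x y)
          (asMove-≋ s′ x y))

    cycleMatricesAfter-triangular : Triangular (CycleMatricesAfter σ)
    cycleMatricesAfter-triangular = record
      { rank             = λ s → dist (source s) (target s)
      ; rankBound        = suc n
      ; rank<bound       = λ s → s≤s (dist≤n (source s) (target s))
      ; pivotRow         = target
      ; pivotCol         = λ s → σ ⟨$⟩ˡ source s
      ; pivot≈1          = pivot≈1
      ; pivot-triangular = pivot-triangular
      }

    cycleMatricesAfter-isBasis : IsBasisOf (CycleMatricesAfter σ) (Span AllPermMatrices)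
    cycleMatricesAfter-isBasis =
      (λ { M (lift (w , _ , P≋)) → span-≋ P≋ (span-gen (lift (σ ∘ₚ w , ≋-refl))) }) ,
      (λ { M (xs , perms , e) → span-≋ e (span-lincomb xs
             (All.map (λ { (lift (u , P≋)) → span-≋ P≋ (perm∈spanAfter σ u) }) perms)) }) ,
      triangular⇒linIndep cycleMatricesAfter-triangular

proposition4 : ∀ {c ℓ : Level} (n : ℕ) → 1 ≤ n →
    (∀ (w : Permutation′ n) → HasIncreasingSubseq w (n ∸ 1) ⇔ IsConsecutiveCycle w)
    × ((R : CommutativeRing c ℓ) →
         Lin.IsBasisOf R (Lin.CycleMatrices R {n}) (Lin.Span R (Lin.AllPermMatrices R {n}))
         × Lin.IsBasisOf R (Lin.CycleW₀Matrices R {n}) (Lin.Span R (Lin.AllPermMatrices R {n})))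
proposition4 (suc n) (s≤s _) =
  (λ w → ⇔-trans (increasing⇔move w) (⇔-sym (consecutiveCycle⇔move w))) ,
  λ R → let open Matrices R in cycleMatricesAfter-isBasis Perm.id , cycleMatricesAfter-isBasis w₀
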